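{- Let $n$ be a nonnegative integer, let $T_{n+2}$ be a tournament on $n+2$ vertices, let $a,b$ be two distinct vertices of $T_{n+2}$, and let $T_n$ be the subtournament of $T_{n+2}$ induced on the remaining $n$ vertices. Then $v(T_{n+2})\le v(T_n)+2$.
   Context: Let $A$ be a finite set of candidates. A voter is a linear order (strict ranking) of $A$, i.e. a permutation $x_1x_2\cdots x_{|A|}$ of $A$, where $x_i$ is preferred over $x_j$ iff $i<j$. A nonempty finite multiset $U$ of voters generates a tournament $T$ on vertex set $A$ if for every pair of distinct $a,b\in A$, the arc $(a,b)$ is in $T$ if and only if strictly more than half of the voters in $U$ prefer $a$ over $b$. For a tournament $T$, $v(T)$ is the minimum cardinality of a multiset of voters generating $T$ (such a multiset always exists). -}

module Defs where

open import Data.Nat using (ℕ; suc; _+_; _*_; _<_; _≤_)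
open import Data.Fin using (Fin)
import Data.Fin as F
open import Data.Bool using (Bool; true; false; not)
open import Data.List using (List; []; _∷_; length; filter)
open import Data.Product using (_×_; Σ; ∃)
open import Function.Bundles using (_↔_; Inverse; _⇔_)
open import Function.Definitions using (Injective)
open import Relation.Binary.PropositionalEquality using (_≡_; _≢_)
open import Relation.Nullary using (¬_)

record Tournament (m : ℕ) : Set where
  field
    arc      : Fin m → Fin m → Bool
    loopless : ∀ a → arc a a ≡ false
    oriented : ∀ a b → a ≢ b → arc a b ≡ not (arc b a)
open Tournament public

-- A voter: a linear order of the candidates Fin m, given as a bijection
-- assigning each candidate its position (0 = most preferred).
Voter : ℕ → Set
Voter m = Fin m ↔ Fin m

position : ∀ {m} → Voter m → Fin m → Fin m
position σ = Inverse.to σ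

prefers? : ∀ {m} → Voter m → Fin m → Fin m → Bool
prefers? σ a b = Data.Nat._<ᵇ_ (F.toℕ (position σ a)) (F.toℕ (position σ b))

count : ∀ {m} → List (Voter m) → Fin m → Fin m → ℕ
count [] a b = 0
count (σ ∷ U) a b with prefers? σ a b
... | true  = suc (count U a b)
... | false = count U a b

NonEmpty : ∀ {A : Set} → List A → Set
NonEmpty xs = 0 < length xs

Generates : ∀ {m} → List (Voter m) → Tournament m → Set
Generates {m} U T =
  NonEmpty U ×
  (∀ (a b : Fin m) → a ≢ b → (arc T a b ≡ true ⇔ length U < 2 * count U a b))

induced : ∀ {k m} (T : Tournament m) (e : Fin k → Fin m) → Injective _≡_ _≡_ e → Tournament k
induced T e inj = record
  { arc      = λ i j → arc T (e i) (e j)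
  ; loopless = λ i → loopless T (e i)
  ; oriented = λ i j i≢j → oriented T (e i) (e j) (λ eq → i≢j (inj eq))
  }

{-# OPTIONS --safe #-}
module Submission where

-- First pass to an odd generating multiset U of T_n: if |U| is even no pair is tied, so dropping
-- one voter changes no majority. Label the vertices of T_{n+2} as a, b and those of T_n, with
-- a → b. Lift the voters of U by placing a above b, alternately above and below all of T_n:
-- pairs inside T_n keep their counts, a beats b unanimously, and a and b each beat every x of
-- T_n in exactly (|U| - 1)/2 lifted voters, two short of a majority among |U| + 2 voters.
-- Two further voters, mutually reverse on T_n, add one vote to every pair inside T_n, and make
-- a beat x in one of them, or in both exactly when a → x; likewise for b.

open import Defs
open import Data.Bool using (Bool; true; false; not; if_then_else_)
open import Data.Bool.Properties using (T-≡)
open import Data.Empty using (⊥-elim)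
open import Data.Fin using (Fin; zero; suc; toℕ; fromℕ<)
import Data.Fin.Properties as Fin
open import Data.Fin.Permutation
  using (Permutation′; permutation; reverse; flip; _∘ₚ_; _⟨$⟩ʳ_; _⟨$⟩ˡ_; inverseˡ; inverseʳ)
open import Data.Fin.Subset using (Subset; _∈_; ∣_∣)
open import Data.Fin.Subset.Properties using (p⊂q⇒∣p∣<∣q∣; ∣⊤∣≡n; ∈⊤)
open import Data.Nat
  using (ℕ; zero; suc; _+_; _*_; _∸_; _<_; _≤_; _<ᵇ_; z≤n; s≤s; s≤s⁻¹; s<s⁻¹; ⌊_/2⌋; ⌈_/2⌉)
open import Data.Nat.Properties
open import Data.List using (List; []; _∷_; length; map)
open import Data.List.Properties using (length-map)
open import Data.Product using (Σ; ∃; _×_; _,_; proj₁; proj₂)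
open import Data.Sum using (_⊎_; inj₁; inj₂)
open import Data.Vec using (tabulate)
open import Data.Vec.Properties using (lookup∘tabulate; []=⇒lookup; lookup⇒[]=)
open import Function using (_∘_)
open import Function.Bundles using (_⇔_; mk⇔; Equivalence)
import Function.Properties.Equivalence as ⇔
open import Function.Definitions using (Injective)
open import Relation.Binary.Definitions using (tri<; tri≈; tri>)
open import Relation.Binary.PropositionalEquality
open import Relation.Nullary using (¬_; yes; no; contradiction)

<ᵇ-true : ∀ {p q} → p < q → (p <ᵇ q) ≡ true
<ᵇ-true p<q = Equivalence.to T-≡ (<⇒<ᵇ p<q)

<ᵇ-false : ∀ {p q} → q ≤ p → (p <ᵇ q) ≡ false
<ᵇ-false {p} {q} q≤p with p <ᵇ q in eq
... | false = refl
... | true  = ⊥-elim (≤⇒≯ q≤p (<ᵇ⇒< p q (Equivalence.from T-≡ eq)))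

<ᵇ-irrefl : ∀ p → (p <ᵇ p) ≡ false
<ᵇ-irrefl p = <ᵇ-false {p} ≤-refl

<ᵇ-flip : ∀ {p q} → p ≢ q → (q <ᵇ p) ≡ not (p <ᵇ q)
<ᵇ-flip {p} {q} p≢q with <-cmp p q
... | tri< p<q _ _ rewrite <ᵇ-true p<q = <ᵇ-false (<⇒≤ p<q)
... | tri≈ _ p≡q _ = ⊥-elim (p≢q p≡q)
... | tri> _ _ q<p rewrite <ᵇ-false (<⇒≤ q<p) = <ᵇ-true q<p

∸-suc-<ᵇ : ∀ {m p q} → p < m → q < m → (m ∸ suc p <ᵇ m ∸ suc q) ≡ (q <ᵇ p)
∸-suc-<ᵇ {m} {p} {q} p<m q<m with <-cmp q p
... | tri< q<p _ _ = trans (<ᵇ-true (∸-monoʳ-< (s≤s q<p) p<m)) (sym (<ᵇ-true q<p))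
... | tri≈ _ refl _ = trans (<ᵇ-irrefl (m ∸ suc p)) (sym (<ᵇ-irrefl p))
... | tri> _ _ p<q =
  trans (<ᵇ-false (<⇒≤ (∸-monoʳ-< (s≤s p<q) q<m))) (sym (<ᵇ-false (<⇒≤ p<q)))

injective⇒preimage : ∀ {m} {f : Fin m → Fin m} → Injective _≡_ _≡_ f → ∀ j → ∃ λ i → f i ≡ j
injective⇒preimage {m} {f} f-inj j with Fin.any? (λ i → f i Fin.≟ j)
... | yes found = found
... | no missing = ⊥-elim (1+n≰n (Fin.injective⇒≤ g-inj))
  where
  g : Fin (suc m) → Fin m
  g zero    = j
  g (suc i) = f i

  g-inj : Injective _≡_ _≡_ g
  g-inj {zero}  {zero}   _  = refl
  g-inj {zero}  {suc i}  eq = ⊥-elim (missing (i , sym eq))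
  g-inj {suc i} {zero}   eq = ⊥-elim (missing (i , eq))
  g-inj {suc i} {suc i'} eq = cong suc (f-inj eq)

permutationOf : ∀ {m} (f : Fin m → Fin m) → Injective _≡_ _≡_ f → Permutation′ m
permutationOf f f-inj = permutation f (proj₁ ∘ preimage) (proj₂ ∘ preimage)
  (λ i → f-inj (proj₂ (preimage (f i))))
  where preimage = injective⇒preimage f-inj

module FromKey {m} (k : Fin m → ℕ) (k-inj : Injective _≡_ _≡_ k) where

  below : Fin m → Subset m
  below x = tabulate (λ z → k z <ᵇ k x)

  ∈-below : ∀ {z x} → z ∈ below x → k z < k x
  ∈-below {z} {x} z∈ = <ᵇ⇒< (k z) (k x) (Equivalence.from T-≡
    (trans (sym (lookup∘tabulate (λ z → k z <ᵇ k _) z)) ([]=⇒lookup z∈)))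

  below-∈ : ∀ {z x} → k z < k x → z ∈ below x
  below-∈ {z} {x} kz<kx = lookup⇒[]= z (below x)
    (trans (lookup∘tabulate (λ z → k z <ᵇ k x) z) (<ᵇ-true kz<kx))

  ∉-below-self : ∀ x → ¬ x ∈ below x
  ∉-below-self x x∈ = <-irrefl refl (∈-below x∈)

  rank : Fin m → ℕ
  rank x = ∣ below x ∣

  rank<m : ∀ x → rank x < m
  rank<m x = subst (rank x <_) (∣⊤∣≡n m)
    (p⊂q⇒∣p∣<∣q∣ ((λ _ → ∈⊤) , x , ∈⊤ , ∉-below-self x))

  rank-mono : ∀ {x y} → k x < k y → rank x < rank y
  rank-mono {x} {y} kx<ky = p⊂q⇒∣p∣<∣q∣
    ((λ z∈ → below-∈ (<-trans (∈-below z∈) kx<ky)) , x , below-∈ kx<ky , ∉-below-self x)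

  rank<ᵇ : ∀ x y → (rank x <ᵇ rank y) ≡ (k x <ᵇ k y)
  rank<ᵇ x y with <-cmp (k x) (k y)
  ... | tri< kx<ky _ _ = trans (<ᵇ-true (rank-mono kx<ky)) (sym (<ᵇ-true kx<ky))
  ... | tri≈ _ kx≡ky _ rewrite k-inj kx≡ky = trans (<ᵇ-irrefl (rank y)) (sym (<ᵇ-irrefl (k y)))
  ... | tri> _ _ ky<kx = trans (<ᵇ-false (<⇒≤ (rank-mono ky<kx))) (sym (<ᵇ-false (<⇒≤ ky<kx)))

  positionOf : Fin m → Fin m
  positionOf x = fromℕ< (rank<m x)

  positionOf-injective : Injective _≡_ _≡_ positionOf
  positionOf-injective {x} {y} eq with <-cmp (k x) (k y)
  ... | tri< kx<ky _ _ = ⊥-elim (<-irrefl rank≡ (rank-mono kx<ky))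
    where rank≡ = subst₂ _≡_ (Fin.toℕ-fromℕ< (rank<m x)) (Fin.toℕ-fromℕ< (rank<m y)) (cong toℕ eq)
  ... | tri≈ _ kx≡ky _ = k-inj kx≡ky
  ... | tri> _ _ ky<kx = ⊥-elim (<-irrefl (sym rank≡) (rank-mono ky<kx))
    where rank≡ = subst₂ _≡_ (Fin.toℕ-fromℕ< (rank<m x)) (Fin.toℕ-fromℕ< (rank<m y)) (cong toℕ eq)

-- Abstract, because unfolding the ranks makes rewriting under count intractable.
abstract
  voterFromKey : ∀ {m} (k : Fin m → ℕ) → Injective _≡_ _≡_ k → Voter m
  voterFromKey k k-inj = permutationOf _ (FromKey.positionOf-injective k k-inj)

  prefers?-voterFromKey : ∀ {m} (k : Fin m → ℕ) (k-inj : Injective _≡_ _≡_ k) x y →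
    prefers? (voterFromKey k k-inj) x y ≡ (k x <ᵇ k y)
  prefers?-voterFromKey k k-inj x y =
    trans (cong₂ _<ᵇ_ (Fin.toℕ-fromℕ< (rank<m x)) (Fin.toℕ-fromℕ< (rank<m y))) (rank<ᵇ x y)
    where open FromKey k k-inj

tieBreak : ∀ {m} → (Fin m → ℕ) → Fin m → ℕ
tieBreak {m} f x = f x * m + toℕ x

tieBreak-mono : ∀ {m} (f : Fin m → ℕ) {x y} → f x < f y → tieBreak f x < tieBreak f y
tieBreak-mono {m} f {x} {y} fx<fy = begin-strict
  f x * m + toℕ x  <⟨ +-monoʳ-< (f x * m) (Fin.toℕ<n x) ⟩
  f x * m + m      ≡⟨ +-comm (f x * m) m ⟩
  suc (f x) * m    ≤⟨ *-monoˡ-≤ m fx<fy ⟩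
  f y * m          ≤⟨ m≤m+n (f y * m) (toℕ y) ⟩
  f y * m + toℕ y  ∎
  where open ≤-Reasoning

tieBreak-inj : ∀ {m} (f : Fin m → ℕ) → Injective _≡_ _≡_ (tieBreak f)
tieBreak-inj {m} f {x} {y} eq with <-cmp (f x) (f y)
... | tri< fx<fy _ _ = ⊥-elim (<-irrefl eq (tieBreak-mono f fx<fy))
... | tri≈ _ fx≡fy _ = Fin.toℕ-injective
  (+-cancelˡ-≡ (f x * m) _ _ (trans eq (cong (λ v → v * m + toℕ y) (sym fx≡fy))))
... | tri> _ _ fy<fx = ⊥-elim (<-irrefl (sym eq) (tieBreak-mono f fy<fx))

rankBy : ∀ {m} → (Fin m → ℕ) → Voter m
rankBy f = voterFromKey (tieBreak f) (tieBreak-inj f)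

prefers?-rankBy : ∀ {m} (f : Fin m → ℕ) x y → f x ≢ f y → prefers? (rankBy f) x y ≡ (f x <ᵇ f y)
prefers?-rankBy f x y fx≢fy =
  trans (prefers?-voterFromKey (tieBreak f) (tieBreak-inj f) x y) tieBreak<ᵇ
  where
  tieBreak<ᵇ : (tieBreak f x <ᵇ tieBreak f y) ≡ (f x <ᵇ f y)
  tieBreak<ᵇ with <-cmp (f x) (f y)
  ... | tri< fx<fy _ _ = trans (<ᵇ-true (tieBreak-mono f fx<fy)) (sym (<ᵇ-true fx<fy))
  ... | tri≈ _ fx≡fy _ = ⊥-elim (fx≢fy fx≡fy)
  ... | tri> _ _ fy<fx =
    trans (<ᵇ-false (<⇒≤ (tieBreak-mono f fy<fx))) (sym (<ᵇ-false (<⇒≤ fy<fx)))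

prefers?-rankBy-cong : ∀ {m} (f g : Fin m → ℕ) {x y} → f x ≡ g x → f y ≡ g y →
  prefers? (rankBy f) x y ≡ prefers? (rankBy g) x y
prefers?-rankBy-cong {m} f g {x} {y} fx≡gx fy≡gy = begin
  prefers? (rankBy f) x y        ≡⟨ prefers?-voterFromKey (tieBreak f) (tieBreak-inj f) x y ⟩
  tieBreak f x <ᵇ tieBreak f y  ≡⟨ cong₂ (λ u v → u * m + toℕ x <ᵇ v * m + toℕ y) fx≡gx fy≡gy ⟩
  tieBreak g x <ᵇ tieBreak g y  ≡⟨ prefers?-voterFromKey (tieBreak g) (tieBreak-inj g) x y ⟨
  prefers? (rankBy g) x y        ∎
  where open ≡-Reasoning

prefers?-reversed : ∀ {m} (σ : Voter m) x y → prefers? (σ ∘ₚ reverse) x y ≡ prefers? σ y x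
prefers?-reversed σ x y = trans
  (cong₂ _<ᵇ_ (Fin.opposite-prop (σ ⟨$⟩ʳ x)) (Fin.opposite-prop (σ ⟨$⟩ʳ y)))
  (∸-suc-<ᵇ (Fin.toℕ<n (σ ⟨$⟩ʳ x)) (Fin.toℕ<n (σ ⟨$⟩ʳ y)))

position-injective : ∀ {m} (σ : Voter m) → Injective _≡_ _≡_ (position σ)
position-injective σ {x} {y} eq =
  trans (sym (inverseˡ σ)) (trans (cong (σ ⟨$⟩ˡ_) eq) (inverseˡ σ))

prefers?-flip : ∀ {m} (σ : Voter m) {x y} → x ≢ y → prefers? σ y x ≡ not (prefers? σ x y)
prefers?-flip σ x≢y = <ᵇ-flip (x≢y ∘ position-injective σ ∘ Fin.toℕ-injective)

bit : Bool → ℕ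
bit true  = 1
bit false = 0

bit-not : ∀ b → bit b + bit (not b) ≡ 1
bit-not true  = refl
bit-not false = refl

bit≤1 : ∀ b → bit b ≤ 1
bit≤1 true  = ≤-refl
bit≤1 false = z≤n

<-bit+ : ∀ b k → (k < bit b + k ⇔ b ≡ true)
<-bit+ true  k = mk⇔ (λ _ → refl) (λ _ → n<1+n k)
<-bit+ false k = mk⇔ (λ k<k → ⊥-elim (<-irrefl refl k<k)) (λ ())

count-∷ : ∀ {m} (σ : Voter m) U x y → count (σ ∷ U) x y ≡ bit (prefers? σ x y) + count U x y
count-∷ σ U x y with prefers? σ x y
... | true  = refl
... | false = refl

count-both : ∀ {m} (U : List (Voter m)) {x y} → x ≢ y → count U x y + count U y x ≡ length U
count-both [] x≢y = refl
count-both (σ ∷ U) {x} {y} x≢y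
  rewrite count-∷ σ U x y | count-∷ σ U y x | prefers?-flip σ x≢y with prefers? σ x y
... | true  = cong suc (count-both U x≢y)
... | false = trans (+-suc (count U x y) (count U y x)) (cong suc (count-both U x≢y))

majority-odd : ∀ k x → (suc (2 * k) < 2 * x ⇔ k < x)
majority-odd k x = mk⇔
  (λ lt → *-cancelˡ-< 2 k x (<-trans (n<1+n _) lt))
  (λ k<x → subst (_≤ 2 * x) (*-suc 2 k) (*-monoʳ-≤ 2 k<x))

majority-unique : ∀ p q {L} → p + q ≡ L → L < 2 * p → ¬ L < 2 * q
majority-unique p q {L} p+q≡L L<2p L<2q = <-irrefl refl (begin-strict
  L + L          <⟨ +-mono-< L<2p L<2q ⟩
  2 * p + 2 * q  ≡⟨ *-distribˡ-+ 2 p q ⟨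
  2 * (p + q)    ≡⟨ cong (2 *_) p+q≡L ⟩
  2 * L          ≡⟨ cong (L +_) (+-identityʳ L) ⟩
  L + L          ∎)
  where open ≤-Reasoning

majority-complete : ∀ p q {L} → p + q ≡ L → L ≢ 2 * p → ¬ L < 2 * p → L < 2 * q
majority-complete p q {L} p+q≡L L≢2p L≮2p = +-cancelˡ-< (2 * p) L (2 * q) (begin-strict
  2 * p + L      <⟨ +-monoˡ-< L (≤∧≢⇒< (≮⇒≥ L≮2p) (L≢2p ∘ sym)) ⟩
  L + L          ≡⟨ cong (L +_) (+-identityʳ L) ⟨
  2 * L          ≡⟨ cong (2 *_) p+q≡L ⟨
  2 * (p + q)    ≡⟨ *-distribˡ-+ 2 p q ⟩
  2 * p + 2 * q  ∎)
  where open ≤-Reasoning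

odd≢even : ∀ {L} k p → L ≡ suc (2 * k) → L ≢ 2 * p
odd≢even k p L≡odd L≡even = even≢odd p k (trans (sym L≡even) L≡odd)

parity : ∀ L → ∃ λ k → L ≡ 2 * k ⊎ L ≡ suc (2 * k)
parity zero = 0 , inj₁ refl
parity (suc L) with parity L
... | k , inj₁ even = k , inj₂ (cong suc even)
... | k , inj₂ odd  = suc k , inj₁ (trans (cong suc odd) (sym (*-suc 2 k)))

⌊1+2n/2⌋≡n : ∀ n → ⌊ suc (2 * n) /2⌋ ≡ n
⌊1+2n/2⌋≡n zero    = refl
⌊1+2n/2⌋≡n (suc n) = cong suc (trans (cong ⌊_/2⌋ (+-suc n (n + 0))) (⌊1+2n/2⌋≡n n))

generates-flip : ∀ {m} (T : Tournament m) (U : List (Voter m)) k → length U ≡ suc (2 * k) →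
  ∀ {x y} → x ≢ y →
  (arc T x y ≡ true ⇔ length U < 2 * count U x y) →
  (arc T y x ≡ true ⇔ length U < 2 * count U y x)
generates-flip T U k odd {x} {y} x≢y gen-xy
  rewrite oriented T y x (x≢y ∘ sym) with arc T x y
... | true  = mk⇔ (λ ()) (λ maj-yx → ⊥-elim
  (majority-unique (count U x y) (count U y x) (count-both U x≢y) (Equivalence.to gen-xy refl) maj-yx))
... | false = mk⇔ (λ _ → majority-complete (count U x y) (count U y x) (count-both U x≢y)
  (odd≢even k (count U x y) odd) (λ maj-xy → contradiction (Equivalence.from gen-xy maj-xy) λ ()))
  (λ _ → refl)

generates-tail : ∀ {m} (T : Tournament m) σ (U : List (Voter m)) k → length U ≡ suc (2 * k) →
  Generates (σ ∷ U) T → Generates U T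
generates-tail T σ U k odd (_ , gen) = subst (0 <_) (sym odd) (s≤s z≤n) , λ x y x≢y →
  mk⇔ (elected x≢y) (elected-arc x≢y)
  where
  elected : ∀ {x y} → x ≢ y → arc T x y ≡ true → length U < 2 * count U x y
  elected {x} {y} x≢y arc-xy = subst (_< 2 * count U x y) (sym odd)
    (Equivalence.from (majority-odd k (count U x y)) (s≤s⁻¹ (<-≤-trans one-more
      (+-monoˡ-≤ (count U x y) (bit≤1 (prefers? σ x y))))))
    where
    one-more : suc k < bit (prefers? σ x y) + count U x y
    one-more = *-cancelˡ-< 2 _ _ (subst₂ _<_ (trans (cong suc odd) (sym (*-suc 2 k)))
      (cong (2 *_) (count-∷ σ U x y)) (Equivalence.to (gen x y x≢y) arc-xy))

  elected-arc : ∀ {x y} → x ≢ y → length U < 2 * count U x y → arc T x y ≡ true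
  elected-arc {x} {y} x≢y maj-xy with arc T x y in arc-xy
  ... | true  = refl
  ... | false = ⊥-elim (majority-unique (count U x y) (count U y x) (count-both U x≢y) maj-xy
    (elected (x≢y ∘ sym) (trans (oriented T y x (x≢y ∘ sym)) (cong not arc-xy))))

odd-generator : ∀ {m} (T : Tournament m) (U : List (Voter m)) → Generates U T →
  Σ (List (Voter m)) λ V → Generates V T × length V ≤ length U × ∃ λ k → length V ≡ suc (2 * k)
odd-generator T (σ ∷ U) gen with parity (length U)
... | k , inj₁ even = σ ∷ U , gen , ≤-refl , k , cong suc even
... | k , inj₂ odd  = U , generates-tail T σ U k odd gen , n≤1+n (length U) , k , odd

relabel : ∀ {m} → Permutation′ m → Voter m → Voter m
relabel Φ σ = flip Φ ∘ₚ σ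

count-relabel : ∀ {m} (Φ : Permutation′ m) W x y →
  count (map (relabel Φ) W) x y ≡ count W (Φ ⟨$⟩ˡ x) (Φ ⟨$⟩ˡ y)
count-relabel Φ []      x y = refl
count-relabel Φ (σ ∷ W) x y = begin
  count (map (relabel Φ) (σ ∷ W)) x y
    ≡⟨ count-∷ (relabel Φ σ) (map (relabel Φ) W) x y ⟩
  bit (prefers? σ (Φ ⟨$⟩ˡ x) (Φ ⟨$⟩ˡ y)) + count (map (relabel Φ) W) x y
    ≡⟨ cong (bit (prefers? σ (Φ ⟨$⟩ˡ x) (Φ ⟨$⟩ˡ y)) +_) (count-relabel Φ W x y) ⟩
  bit (prefers? σ (Φ ⟨$⟩ˡ x) (Φ ⟨$⟩ˡ y)) + count W (Φ ⟨$⟩ˡ x) (Φ ⟨$⟩ˡ y)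
    ≡⟨ count-∷ σ W (Φ ⟨$⟩ˡ x) (Φ ⟨$⟩ˡ y) ⟨
  count (σ ∷ W) (Φ ⟨$⟩ˡ x) (Φ ⟨$⟩ˡ y)
    ∎
  where open ≡-Reasoning

generates-relabel : ∀ {m} (T : Tournament m) (Φ : Permutation′ m)
  (Φ-inj : Injective _≡_ _≡_ (Φ ⟨$⟩ʳ_)) (W : List (Voter m)) →
  Generates W (induced T (Φ ⟨$⟩ʳ_) Φ-inj) → Generates (map (relabel Φ) W) T
generates-relabel T Φ _ W (nonempty , gen) =
  subst (0 <_) (sym (length-map (relabel Φ) W)) nonempty , gen-relabelled
  where
  gen-relabelled : ∀ x y → x ≢ y →
    (arc T x y ≡ true ⇔ length (map (relabel Φ) W) < 2 * count (map (relabel Φ) W) x y)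
  gen-relabelled x y x≢y rewrite length-map (relabel Φ) W | count-relabel Φ W x y =
    subst₂ (λ u v → arc T u v ≡ true ⇔ length W < 2 * count W (Φ ⟨$⟩ˡ x) (Φ ⟨$⟩ˡ y))
      (inverseʳ Φ) (inverseʳ Φ) (gen (Φ ⟨$⟩ˡ x) (Φ ⟨$⟩ˡ y) (x≢y ∘ position-injective (flip Φ)))

pattern α      = Fin.zero
pattern β      = Fin.suc Fin.zero
pattern rest i = Fin.suc (Fin.suc i)

rest-injective : ∀ {n} → Injective _≡_ _≡_ (λ (i : Fin n) → rest i)
rest-injective refl = refl

liftKey : ∀ {n} → Bool → Voter n → Fin (suc (suc n)) → ℕ
liftKey     true  π α        = 0
liftKey     true  π β        = 1
liftKey     true  π (rest i) = 2 + toℕ (position π i)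
liftKey {n} false π α        = n
liftKey {n} false π β        = suc n
liftKey     false π (rest i) = toℕ (position π i)

lift : ∀ {n} → Bool → Voter n → Voter (suc (suc n))
lift onTop π = rankBy (liftKey onTop π)

prefers?-lift-αβ : ∀ {n} onTop (π : Voter n) → prefers? (lift onTop π) α β ≡ true
prefers?-lift-αβ true  π = prefers?-rankBy (liftKey true π) α β (λ ())
prefers?-lift-αβ {n} false π =
  trans (prefers?-rankBy (liftKey false π) α β (<⇒≢ (n<1+n n))) (<ᵇ-true (n<1+n n))

prefers?-lift-α : ∀ {n} onTop (π : Voter n) j → prefers? (lift onTop π) α (rest j) ≡ onTop
prefers?-lift-α true  π j = prefers?-rankBy (liftKey true π) α (rest j) (λ ())
prefers?-lift-α false π j =
  trans (prefers?-rankBy (liftKey false π) α (rest j) (>⇒≢ below-n)) (<ᵇ-false (<⇒≤ below-n))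
  where below-n = Fin.toℕ<n (position π j)

prefers?-lift-β : ∀ {n} onTop (π : Voter n) j → prefers? (lift onTop π) β (rest j) ≡ onTop
prefers?-lift-β true  π j = prefers?-rankBy (liftKey true π) β (rest j) (λ ())
prefers?-lift-β false π j =
  trans (prefers?-rankBy (liftKey false π) β (rest j) (>⇒≢ below-n)) (<ᵇ-false (<⇒≤ below-n))
  where below-n = m<n⇒m<1+n (Fin.toℕ<n (position π j))

prefers?-lift-rest : ∀ {n} onTop (π : Voter n) {i j} → i ≢ j →
  prefers? (lift onTop π) (rest i) (rest j) ≡ prefers? π i j
prefers?-lift-rest true  π i≢j = prefers?-rankBy (liftKey true π) (rest _) (rest _)
  (i≢j ∘ position-injective π ∘ Fin.toℕ-injective ∘ suc-injective ∘ suc-injective)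
prefers?-lift-rest false π i≢j = prefers?-rankBy (liftKey false π) (rest _) (rest _)
  (i≢j ∘ position-injective π ∘ Fin.toℕ-injective)

extend : ∀ {n} → Bool → List (Voter n) → List (Voter (suc (suc n)))
extend onTop []      = []
extend onTop (π ∷ U) = lift onTop π ∷ extend (not onTop) U

length-extend : ∀ {n} onTop (U : List (Voter n)) → length (extend onTop U) ≡ length U
length-extend onTop []      = refl
length-extend onTop (π ∷ U) = cong suc (length-extend (not onTop) U)

count-extend-αβ : ∀ {n} onTop (U : List (Voter n)) → count (extend onTop U) α β ≡ length U
count-extend-αβ onTop [] = refl
count-extend-αβ onTop (π ∷ U) rewrite count-∷ (lift onTop π) (extend (not onTop) U) α β
  | prefers?-lift-αβ onTop π = cong suc (count-extend-αβ (not onTop) U)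

count-extend-alternating : ∀ {n} {x y : Fin (suc (suc n))} →
  (∀ onTop (π : Voter n) → prefers? (lift onTop π) x y ≡ onTop) →
  ∀ onTop U → count (extend onTop U) x y ≡ (if onTop then ⌈ length U /2⌉ else ⌊ length U /2⌋)
count-extend-alternating lifted true  []      = refl
count-extend-alternating lifted false []      = refl
count-extend-alternating {x = x} {y} lifted true (π ∷ U)
  rewrite count-∷ (lift true π) (extend false U) x y | lifted true π
  = cong suc (count-extend-alternating lifted false U)
count-extend-alternating {x = x} {y} lifted false (π ∷ U)
  rewrite count-∷ (lift false π) (extend true U) x y | lifted false π
  = count-extend-alternating lifted true U

count-extend-rest : ∀ {n} onTop (U : List (Voter n)) {i j} → i ≢ j →
  count (extend onTop U) (rest i) (rest j) ≡ count U i j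
count-extend-rest onTop [] i≢j = refl
count-extend-rest onTop (π ∷ U) {i} {j} i≢j
  rewrite count-∷ (lift onTop π) (extend (not onTop) U) (rest i) (rest j)
  | count-∷ π U i j | prefers?-lift-rest onTop π i≢j
  = cong (bit (prefers? π i j) +_) (count-extend-rest (not onTop) U i≢j)

-- A candidate x of T_n lies in class 0, 1, 2 or 3 when (a → x, b → x) is (1,0), (1,1), (0,1) or
-- (0,0). Under balanceKey i j class c sits at 2c + 1 while a and b sit just before classes i and j:
-- first ranks a, class 0, b, classes 1 to 3, and second reverses class 0, class 1, a, class 2, b,
-- class 3, whence class-votes.
class : Bool → Bool → ℕ
class true  false = 0
class true  true  = 1
class false true  = 2
class false false = 3

class-votes : ∀ A B →
  bit (2 * 0 <ᵇ suc (2 * class A B)) + bit (suc (2 * class A B) <ᵇ 2 * 2) ≡ suc (bit A) ×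
  bit (2 * 1 <ᵇ suc (2 * class A B)) + bit (suc (2 * class A B) <ᵇ 2 * 3) ≡ suc (bit B)
class-votes true  false = refl , refl
class-votes true  true  = refl , refl
class-votes false true  = refl , refl
class-votes false false = refl , refl

module Extension {n} (T : Tournament (suc (suc n))) where

  classOf : Fin n → ℕ
  classOf x = class (arc T α (rest x)) (arc T β (rest x))

  balanceKey : ℕ → ℕ → Fin (suc (suc n)) → ℕ
  balanceKey i j α        = 2 * i
  balanceKey i j β        = 2 * j
  balanceKey i j (rest x) = suc (2 * classOf x)

  first second : Voter (suc (suc n))
  first  = rankBy (balanceKey 0 1)
  second = rankBy (balanceKey 2 3) ∘ₚ reverse

  balance : Fin (suc (suc n)) → Fin (suc (suc n)) → ℕ
  balance x y = bit (prefers? first x y) + bit (prefers? second x y)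

  balance-αβ : balance α β ≡ 1
  balance-αβ rewrite prefers?-rankBy (balanceKey 0 1) α β (λ ())
    | prefers?-reversed (rankBy (balanceKey 2 3)) α β
    | prefers?-rankBy (balanceKey 2 3) β α (λ ()) = refl

  balance-α : ∀ x → balance α (rest x) ≡ suc (bit (arc T α (rest x)))
  balance-α x rewrite prefers?-rankBy (balanceKey 0 1) α (rest x) (even≢odd 0 (classOf x))
    | prefers?-reversed (rankBy (balanceKey 2 3)) α (rest x)
    | prefers?-rankBy (balanceKey 2 3) (rest x) α (even≢odd 2 (classOf x) ∘ sym)
    = proj₁ (class-votes (arc T α (rest x)) (arc T β (rest x)))

  balance-β : ∀ x → balance β (rest x) ≡ suc (bit (arc T β (rest x)))
  balance-β x rewrite prefers?-rankBy (balanceKey 0 1) β (rest x) (even≢odd 1 (classOf x))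
    | prefers?-reversed (rankBy (balanceKey 2 3)) β (rest x)
    | prefers?-rankBy (balanceKey 2 3) (rest x) β (even≢odd 3 (classOf x) ∘ sym)
    = proj₂ (class-votes (arc T α (rest x)) (arc T β (rest x)))

  balance-rest : ∀ {i j} → i ≢ j → balance (rest i) (rest j) ≡ 1
  balance-rest {i} {j} i≢j
    rewrite prefers?-reversed (rankBy (balanceKey 2 3)) (rest i) (rest j)
    | prefers?-rankBy-cong (balanceKey 2 3) (balanceKey 0 1) {rest j} {rest i} refl refl
    | prefers?-flip first {rest i} {rest j} (i≢j ∘ rest-injective)
    = bit-not (prefers? first (rest i) (rest j))

  extension : List (Voter n) → List (Voter (suc (suc n)))
  extension U = first ∷ second ∷ extend false U

  count-extension : ∀ U x y → count (extension U) x y ≡ balance x y + count (extend false U) x y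
  count-extension U x y = begin
    count (extension U) x y
      ≡⟨ count-∷ first (second ∷ extend false U) x y ⟩
    bit (prefers? first x y) + count (second ∷ extend false U) x y
      ≡⟨ cong (bit (prefers? first x y) +_) (count-∷ second (extend false U) x y) ⟩
    bit (prefers? first x y) + (bit (prefers? second x y) + count (extend false U) x y)
      ≡⟨ +-assoc (bit (prefers? first x y)) _ _ ⟨
    balance x y + count (extend false U) x y
      ∎
    where open ≡-Reasoning

  generates-extension : (U : List (Voter n)) (k : ℕ) → length U ≡ suc (2 * k) →
    arc T α β ≡ true → Generates U (induced T (λ i → rest i) rest-injective) →
    Generates (extension U) T
  generates-extension U k odd α→β (_ , gen-U) = s≤s z≤n , gen
    where
    W = extension U

    odd-W : length W ≡ suc (2 * suc k)
    odd-W = trans (cong (λ L → suc (suc L)) (trans (length-extend false U) odd))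
      (cong suc (sym (*-suc 2 k)))

    half-U : ⌊ length U /2⌋ ≡ k
    half-U = trans (cong ⌊_/2⌋ odd) (⌊1+2n/2⌋≡n k)

    gen-by-count : ∀ {x y c} → count W x y ≡ suc c → (arc T x y ≡ true ⇔ k < c) →
      (arc T x y ≡ true ⇔ length W < 2 * count W x y)
    gen-by-count {c = c} count≡ arc⇔ rewrite count≡ | odd-W =
      ⇔.trans arc⇔ (⇔.sym (⇔.trans (majority-odd (suc k) (suc c)) (mk⇔ s<s⁻¹ s≤s)))

    gen-αβ : arc T α β ≡ true ⇔ length W < 2 * count W α β
    gen-αβ = gen-by-count
      (trans (count-extension U α β) (cong₂ _+_ balance-αβ (count-extend-αβ false U)))
      (mk⇔ (λ _ → subst (k <_) (sym odd) (s≤s (m≤m+n k (k + 0)))) (λ _ → α→β))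

    gen-α : ∀ j → arc T α (rest j) ≡ true ⇔ length W < 2 * count W α (rest j)
    gen-α j = gen-by-count
      (trans (count-extension U α (rest j)) (cong₂ _+_ (balance-α j)
        (trans (count-extend-alternating (λ onTop π → prefers?-lift-α onTop π j) false U) half-U)))
      (⇔.sym (<-bit+ (arc T α (rest j)) k))

    gen-β : ∀ j → arc T β (rest j) ≡ true ⇔ length W < 2 * count W β (rest j)
    gen-β j = gen-by-count
      (trans (count-extension U β (rest j)) (cong₂ _+_ (balance-β j)
        (trans (count-extend-alternating (λ onTop π → prefers?-lift-β onTop π j) false U) half-U)))
      (⇔.sym (<-bit+ (arc T β (rest j)) k))

    gen-rest : ∀ {i j} → i ≢ j →
      arc T (rest i) (rest j) ≡ true ⇔ length W < 2 * count W (rest i) (rest j)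
    gen-rest {i} {j} i≢j = gen-by-count
      (trans (count-extension U (rest i) (rest j))
        (cong₂ _+_ (balance-rest i≢j) (count-extend-rest false U i≢j)))
      (⇔.trans (gen-U i j i≢j)
        (subst (λ L → L < 2 * count U i j ⇔ k < count U i j) (sym odd)
          (majority-odd k (count U i j))))

    flipped = generates-flip T W (suc k) odd-W

    gen : ∀ x y → x ≢ y → (arc T x y ≡ true ⇔ length W < 2 * count W x y)
    gen α        α        α≢α   = ⊥-elim (α≢α refl)
    gen α        β        _     = gen-αβ
    gen α        (rest j) _     = gen-α j
    gen β        α        β≢α   = flipped (β≢α ∘ sym) gen-αβ
    gen β        β        β≢β   = ⊥-elim (β≢β refl)
    gen β        (rest j) _     = gen-β j
    gen (rest i) α        r≢α   = flipped (r≢α ∘ sym) (gen-α i)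
    gen (rest i) β        r≢β   = flipped (r≢β ∘ sym) (gen-β i)
    gen (rest i) (rest j) ri≢rj = gen-rest (ri≢rj ∘ cong rest)

label : ∀ {n} → Fin (suc (suc n)) → Fin (suc (suc n)) → (Fin n → Fin (suc (suc n))) →
  Fin (suc (suc n)) → Fin (suc (suc n))
label a b e α        = a
label a b e β        = b
label a b e (rest i) = e i

label-injective : ∀ {n} {a b} {e : Fin n → Fin (suc (suc n))} → a ≢ b → Injective _≡_ _≡_ e →
  (∀ i → e i ≢ a) → (∀ i → e i ≢ b) → Injective _≡_ _≡_ (label a b e)
label-injective a≢b e-inj e≢a e≢b {α}      {α}      _  = refl
label-injective a≢b e-inj e≢a e≢b {α}      {β}      eq = ⊥-elim (a≢b eq)
label-injective a≢b e-inj e≢a e≢b {α}      {rest j} eq = ⊥-elim (e≢a j (sym eq))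
label-injective a≢b e-inj e≢a e≢b {β}      {α}      eq = ⊥-elim (a≢b (sym eq))
label-injective a≢b e-inj e≢a e≢b {β}      {β}      _  = refl
label-injective a≢b e-inj e≢a e≢b {β}      {rest j} eq = ⊥-elim (e≢b j (sym eq))
label-injective a≢b e-inj e≢a e≢b {rest i} {α}      eq = ⊥-elim (e≢a i eq)
label-injective a≢b e-inj e≢a e≢b {rest i} {β}      eq = ⊥-elim (e≢b i eq)
label-injective a≢b e-inj e≢a e≢b {rest i} {rest j} eq = cong rest (e-inj eq)

relabelled-extension : ∀ {n} (T : Tournament (suc (suc n))) {a b} → a ≢ b → arc T a b ≡ true →
  {e : Fin n → Fin (suc (suc n))} (e-inj : Injective _≡_ _≡_ e) →
  (∀ i → e i ≢ a) → (∀ i → e i ≢ b) →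
  (U : List (Voter n)) (k : ℕ) → length U ≡ suc (2 * k) → Generates U (induced T e e-inj) →
  Σ (List (Voter (suc (suc n)))) λ W → Generates W T × length W ≡ suc (suc (length U))
relabelled-extension T {a} {b} a≢b a→b {e} e-inj e≢a e≢b U k odd gen =
  map (relabel Φ) (extension U) ,
  generates-relabel T Φ φ-inj (extension U) (generates-extension U k odd a→b gen) ,
  trans (length-map (relabel Φ) (extension U)) (cong (λ L → suc (suc L)) (length-extend false U))
  where
  φ-inj = label-injective a≢b e-inj e≢a e≢b
  Φ = permutationOf (label a b e) φ-inj
  open Extension (induced T (label a b e) φ-inj)

two-more-voters : ∀ {n} (T : Tournament (suc (suc n))) {a b} → a ≢ b →
  {e : Fin n → Fin (suc (suc n))} (e-inj : Injective _≡_ _≡_ e) →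
  (∀ i → e i ≢ a) → (∀ i → e i ≢ b) →
  (U : List (Voter n)) (k : ℕ) → length U ≡ suc (2 * k) → Generates U (induced T e e-inj) →
  Σ (List (Voter (suc (suc n)))) λ W → Generates W T × length W ≡ suc (suc (length U))
two-more-voters T {a} {b} a≢b e-inj e≢a e≢b U k odd gen with arc T a b in a→b
... | true  = relabelled-extension T a≢b a→b e-inj e≢a e≢b U k odd gen
... | false = relabelled-extension T (a≢b ∘ sym) b→a e-inj e≢b e≢a U k odd gen
  where b→a = trans (oriented T b a (a≢b ∘ sym)) (cong not a→b)

theorem1 : (n : ℕ) (T : Tournament (suc (suc n))) (a b : Fin (suc (suc n))) → a ≢ b →
    (e : Fin n → Fin (suc (suc n))) (inj : Injective _≡_ _≡_ e) →
    (∀ i → e i ≢ a) → (∀ i → e i ≢ b) →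
    (U : List (Voter n)) → Generates U (induced T e inj) →
    Σ (List (Voter (suc (suc n)))) λ W → Generates W T × length W ≤ length U + 2
theorem1 n T a b a≢b e inj e≢a e≢b U gen
  with V , gen-V , V≤U , k , odd ← odd-generator (induced T e inj) U gen
  with W , gen-W , W≡2+V ← two-more-voters T a≢b inj e≢a e≢b V k odd gen-V
  = W , gen-W , (begin
      length W          ≡⟨ W≡2+V ⟩
      2 + length V      ≤⟨ +-monoʳ-≤ 2 V≤U ⟩
      2 + length U      ≡⟨ +-comm 2 (length U) ⟩
      length U + 2      ∎)
  where open ≤-Reasoning
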